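{- Let $\beta_k=\sum_{j=0}^{k}\binom{k}{j}^2\binom{k+j}{j}$ for $k\in\mathbb{N}$. For any positive integer $n$, \[\sum_{k=0}^{n-1}(11k^2+13k+4)\beta_k\equiv0\pmod{2n^2},\] \[\sum_{k=0}^{n-1}(11k^2+9k+2)(-1)^k\beta_k\equiv0\pmod{2n^2},\] \[\sum_{k=0}^{n-1}(11k^3+7k^2-1)(-1)^k\beta_k\equiv0\pmod{n^2}.\]
   Context: The numbers $\beta_k$ are the Apéry numbers $\beta_k=\sum_{j=0}^{k}\binom{k}{j}^2\binom{k+j}{j}$. -}

module Defs where

open import Data.Nat as ℕ using (ℕ; zero; suc)
open import Data.Nat.Combinatorics using (_C_)
open import Data.Integer as ℤ using (ℤ; +_)

sumℕ : ℕ → (ℕ → ℕ) → ℕ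
sumℕ zero    f = 0
sumℕ (suc n) f = sumℕ n f ℕ.+ f n

sumℤ : ℕ → (ℕ → ℤ) → ℤ
sumℤ zero    f = + 0
sumℤ (suc n) f = sumℤ n f ℤ.+ f n

β : ℕ → ℕ
β k = sumℕ (suc k) (λ j → (k C j) ℕ.* (k C j) ℕ.* ((k ℕ.+ j) C j))

sgn : ℕ → ℤ
sgn zero    = + 1
sgn (suc k) = ℤ.- sgn k

-- Each sum has a closed form found by the WZ method. Put T(n,j) = C(n,j+1)² C(n+j,j) p(n,j) for a
-- suitable polynomial p. A recurrence T(n+1,j) = ε T(n,j) + q(n) C(n,j)² C(n+j,j) + R(n,j+1) − R(n,j)
-- (ε = ±1) telescopes in j to Σ_j T(n+1,j) = ε Σ_j T(n,j) + q(n) β_n, so by induction the weighted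
-- sum Σ_{k<n} ε^k q(k) β_k equals ±Σ_{j<n} T(n,j). Dividing the recurrence by C(n,j−1)² C(n+j,j)
-- turns it into a polynomial identity in n and j, checked by the ring solver. Divisibility then
-- holds termwise: by absorption and C(m+1+j,j) C(m+1,j+1) = C(m+1+j,2j+1) C(2j+1,j), each
-- T(m+1,j) is 2(m+1)² (resp. (m+1)²) times an explicit integer combination of binomial coefficients.

module Submission where

open import Defs
open import Data.Nat as ℕ using (ℕ; NonZero)
open import Data.Integer as ℤ using (ℤ; +_; _*_; _+_; _-_)
open import Data.Integer.Divisibility using (_∣_)
open import Data.Product using (_×_)
open import Data.Product using (_,_)
open import Data.Integer using (-_)
import Data.Integer.Properties as ℤₚ
open import Data.Integer.Tactic.RingSolver using (solve-∀; solve)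
open import Data.List using (_∷_; [])
open import Data.Nat.Base using (zero; suc; _!)
open import Data.Nat.Combinatorics using (_C_; nCk+nC[k+1]≡[n+1]C[k+1]; k>n⇒nCk≡0; nC1≡n)
import Data.Nat.Divisibility as ℕDiv
import Data.Nat.Properties as ℕₚ
import Data.Nat.Tactic.RingSolver as ℕSolver
open import Relation.Binary.PropositionalEquality
open import Relation.Nullary using (yes; no)

[1+k]*[1+n]C[1+k]≡[1+n]*nCk : ∀ n k → suc k ℕ.* (suc n C suc k) ≡ suc n ℕ.* (n C k)
[1+k]*[1+n]C[1+k]≡[1+n]*nCk zero    zero    = refl
[1+k]*[1+n]C[1+k]≡[1+n]*nCk zero    (suc k) = ℕₚ.*-zeroʳ (suc (suc k))
[1+k]*[1+n]C[1+k]≡[1+n]*nCk (suc n) zero    = trans (ℕₚ.*-identityˡ _) (trans (nC1≡n (suc (suc n))) (sym (ℕₚ.*-identityʳ (suc (suc n)))))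
[1+k]*[1+n]C[1+k]≡[1+n]*nCk (suc n) (suc k) = begin
  (2 ℕ.+ k) ℕ.* (suc (suc n) C suc (suc k))                 ≡⟨ cong ((2 ℕ.+ k) ℕ.*_) (nCk+nC[k+1]≡[n+1]C[k+1] (suc n) (suc k)) ⟨
  (2 ℕ.+ k) ℕ.* (a ℕ.+ b)                                   ≡⟨ regroup k a b ⟩
  a ℕ.+ (1 ℕ.+ k) ℕ.* a ℕ.+ (2 ℕ.+ k) ℕ.* b                 ≡⟨ cong₂ (λ u v → a ℕ.+ u ℕ.+ v) ([1+k]*[1+n]C[1+k]≡[1+n]*nCk n k) ([1+k]*[1+n]C[1+k]≡[1+n]*nCk n (suc k)) ⟩
  a ℕ.+ (1 ℕ.+ n) ℕ.* (n C k) ℕ.+ (1 ℕ.+ n) ℕ.* (n C suc k) ≡⟨ ℕₚ.+-assoc a _ _ ⟩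
  a ℕ.+ ((1 ℕ.+ n) ℕ.* (n C k) ℕ.+ (1 ℕ.+ n) ℕ.* (n C suc k)) ≡⟨ cong (a ℕ.+_) (ℕₚ.*-distribˡ-+ (suc n) (n C k) (n C suc k)) ⟨
  a ℕ.+ (1 ℕ.+ n) ℕ.* (n C k ℕ.+ n C suc k)                 ≡⟨ cong (λ t → a ℕ.+ (1 ℕ.+ n) ℕ.* t) (nCk+nC[k+1]≡[n+1]C[k+1] n k) ⟩
  (2 ℕ.+ n) ℕ.* a                                           ∎
  where
  open ≡-Reasoning
  a = suc n C suc k
  b = suc n C suc (suc k)
  regroup : ∀ k a b → (2 ℕ.+ k) ℕ.* (a ℕ.+ b) ≡ a ℕ.+ (1 ℕ.+ k) ℕ.* a ℕ.+ (2 ℕ.+ k) ℕ.* b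
  regroup = ℕSolver.solve-∀

[a+b]Ca*[a!*b!]≡[a+b]! : ∀ a b → ((a ℕ.+ b) C a) ℕ.* (a ! ℕ.* b !) ≡ (a ℕ.+ b) !
[a+b]Ca*[a!*b!]≡[a+b]! zero    b = trans (ℕₚ.*-identityˡ _) (ℕₚ.+-identityʳ (b !))
[a+b]Ca*[a!*b!]≡[a+b]! (suc a) b = begin
  (n C suc a) ℕ.* ((suc a ℕ.* a !) ℕ.* b !)    ≡⟨ regroup (n C suc a) (suc a) (a !) (b !) ⟩
  (suc a ℕ.* (n C suc a)) ℕ.* (a ! ℕ.* b !)    ≡⟨ cong (ℕ._* (a ! ℕ.* b !)) ([1+k]*[1+n]C[1+k]≡[1+n]*nCk (a ℕ.+ b) a) ⟩
  (n ℕ.* ((a ℕ.+ b) C a)) ℕ.* (a ! ℕ.* b !)     ≡⟨ ℕₚ.*-assoc n ((a ℕ.+ b) C a) (a ! ℕ.* b !) ⟩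
  n ℕ.* (((a ℕ.+ b) C a) ℕ.* (a ! ℕ.* b !))     ≡⟨ cong (n ℕ.*_) ([a+b]Ca*[a!*b!]≡[a+b]! a b) ⟩
  n ℕ.* (a ℕ.+ b) !                            ∎
  where
  open ≡-Reasoning
  n = suc a ℕ.+ b
  regroup : ∀ c s x y → c ℕ.* ((s ℕ.* x) ℕ.* y) ≡ (s ℕ.* c) ℕ.* (x ℕ.* y)
  regroup = ℕSolver.solve-∀

[b+c+a]Ca*[b+c]Cb≡[b+c+a]C[a+b]*[a+b]Ca : ∀ a b c →
  ((b ℕ.+ c ℕ.+ a) C a) ℕ.* ((b ℕ.+ c) C b) ≡ ((b ℕ.+ c ℕ.+ a) C (a ℕ.+ b)) ℕ.* ((a ℕ.+ b) C a)
[b+c+a]Ca*[b+c]Cb≡[b+c+a]C[a+b]*[a+b]Ca a b c =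
  ℕₚ.*-cancelʳ-≡ _ _ (a ! ℕ.* (b ! ℕ.* c !)) {{ℕₚ.m*n≢0 (a !) _ {{a !≢0}} {{b !* c !≢0}}}} (begin
    ((N C a) ℕ.* ((b ℕ.+ c) C b)) ℕ.* (a ! ℕ.* (b ! ℕ.* c !))         ≡⟨ regroupˡ (N C a) ((b ℕ.+ c) C b) (a !) (b !) (c !) ⟩
    (N C a) ℕ.* (a ! ℕ.* (((b ℕ.+ c) C b) ℕ.* (b ! ℕ.* c !)))         ≡⟨ cong (λ t → (N C a) ℕ.* (a ! ℕ.* t)) ([a+b]Ca*[a!*b!]≡[a+b]! b c) ⟩
    (N C a) ℕ.* (a ! ℕ.* (b ℕ.+ c) !)                                 ≡⟨ a+b≡n⇒nCa*[a!*b!]≡n! a (b ℕ.+ c) (ℕₚ.+-comm a (b ℕ.+ c)) ⟩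
    N !                                                               ≡⟨ a+b≡n⇒nCa*[a!*b!]≡n! (a ℕ.+ b) c (reorder a b c) ⟨
    (N C (a ℕ.+ b)) ℕ.* ((a ℕ.+ b) ! ℕ.* c !)                         ≡⟨ cong (λ t → (N C (a ℕ.+ b)) ℕ.* (t ℕ.* c !)) ([a+b]Ca*[a!*b!]≡[a+b]! a b) ⟨
    (N C (a ℕ.+ b)) ℕ.* ((((a ℕ.+ b) C a) ℕ.* (a ! ℕ.* b !)) ℕ.* c !) ≡⟨ regroupʳ (N C (a ℕ.+ b)) ((a ℕ.+ b) C a) (a !) (b !) (c !) ⟩
    ((N C (a ℕ.+ b)) ℕ.* ((a ℕ.+ b) C a)) ℕ.* (a ! ℕ.* (b ! ℕ.* c !)) ∎)
  where
  open ≡-Reasoning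
  open ℕₚ using (_!≢0; _!*_!≢0)
  N = b ℕ.+ c ℕ.+ a
  a+b≡n⇒nCa*[a!*b!]≡n! : ∀ {n} a b → a ℕ.+ b ≡ n → (n C a) ℕ.* (a ! ℕ.* b !) ≡ n !
  a+b≡n⇒nCa*[a!*b!]≡n! a b refl = [a+b]Ca*[a!*b!]≡[a+b]! a b
  regroupˡ : ∀ x y u v w → (x ℕ.* y) ℕ.* (u ℕ.* (v ℕ.* w)) ≡ x ℕ.* (u ℕ.* (y ℕ.* (v ℕ.* w)))
  regroupˡ = ℕSolver.solve-∀
  regroupʳ : ∀ x y u v w → x ℕ.* ((y ℕ.* (u ℕ.* v)) ℕ.* w) ≡ (x ℕ.* y) ℕ.* (u ℕ.* (v ℕ.* w))
  regroupʳ = ℕSolver.solve-∀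
  reorder : ∀ a b c → a ℕ.+ b ℕ.+ c ≡ b ℕ.+ c ℕ.+ a
  reorder = ℕSolver.solve-∀

binom : ℕ → ℕ → ℤ
binom n k = + (n C k)

C[n,k]+C[n,1+k]≡C[1+n,1+k] : ∀ n k → binom n k + binom n (suc k) ≡ binom (suc n) (suc k)
C[n,k]+C[n,1+k]≡C[1+n,1+k] n k = trans (sym (ℤₚ.pos-+ (n C k) (n C suc k))) (cong +_ (nCk+nC[k+1]≡[n+1]C[k+1] n k))

C[1+n,1+k]*[1+k]≡[1+n]*C[n,k] : ∀ n k → binom (suc n) (suc k) * (+ 1 + + k) ≡ (+ 1 + + n) * binom n k
C[1+n,1+k]*[1+k]≡[1+n]*C[n,k] n k = begin
  binom (suc n) (suc k) * + suc k     ≡⟨ ℤₚ.*-comm (binom (suc n) (suc k)) (+ suc k) ⟩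
  + suc k * binom (suc n) (suc k)     ≡⟨ ℤₚ.pos-* (suc k) (suc n C suc k) ⟨
  + (suc k ℕ.* (suc n C suc k))       ≡⟨ cong +_ ([1+k]*[1+n]C[1+k]≡[1+n]*nCk n k) ⟩
  + (suc n ℕ.* (n C k))               ≡⟨ ℤₚ.pos-* (suc n) (n C k) ⟩
  + suc n * binom n k                 ∎
  where open ≡-Reasoning

C[n,1+k]*[1+k]≡[n-k]*C[n,k] : ∀ n k → binom n (suc k) * (+ 1 + + k) ≡ (+ n - + k) * binom n k
C[n,1+k]*[1+k]≡[n-k]*C[n,k] n k = begin
  binom n (suc k) * (+ 1 + + k)                                   ≡⟨ split (binom n k) (binom n (suc k)) (+ 1 + + k) ⟩
  (binom n k + binom n (suc k)) * (+ 1 + + k) - binom n k * (+ 1 + + k) ≡⟨ cong (λ c → c * (+ 1 + + k) - binom n k * (+ 1 + + k)) (C[n,k]+C[n,1+k]≡C[1+n,1+k] n k) ⟩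
  binom (suc n) (suc k) * (+ 1 + + k) - binom n k * (+ 1 + + k)   ≡⟨ cong (_- binom n k * (+ 1 + + k)) (C[1+n,1+k]*[1+k]≡[1+n]*C[n,k] n k) ⟩
  (+ 1 + + n) * binom n k - binom n k * (+ 1 + + k)               ≡⟨ collect (+ n) (+ k) (binom n k) ⟩
  (+ n - + k) * binom n k                                         ∎
  where
  open ≡-Reasoning
  split : ∀ a b c → b * c ≡ (a + b) * c - a * c
  split = solve-∀
  collect : ∀ n k a → (+ 1 + n) * a - a * (+ 1 + k) ≡ (n - k) * a
  collect = solve-∀

C[1+n,k]*[1+n-k]≡[1+n]*C[n,k] : ∀ n k → binom (suc n) k * (+ 1 + + n - + k) ≡ (+ 1 + + n) * binom n k
C[1+n,k]*[1+n-k]≡[1+n]*C[n,k] n k = begin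
  binom (suc n) k * (+ suc n - + k)   ≡⟨ ℤₚ.*-comm (binom (suc n) k) (+ suc n - + k) ⟩
  (+ suc n - + k) * binom (suc n) k   ≡⟨ C[n,1+k]*[1+k]≡[n-k]*C[n,k] (suc n) k ⟨
  binom (suc n) (suc k) * + suc k     ≡⟨ C[1+n,1+k]*[1+k]≡[1+n]*C[n,k] n k ⟩
  + suc n * binom n k                 ∎
  where open ≡-Reasoning

C[n,1+n]≡0 : ∀ n → binom n (suc n) ≡ + 0
C[n,1+n]≡0 n = cong +_ (k>n⇒nCk≡0 (ℕₚ.n<1+n n))

C[n,1]≡n : ∀ n → binom n 1 ≡ + n
C[n,1]≡n n = cong +_ (nC1≡n n)

sum-cong : ∀ n {f g : ℕ → ℤ} → (∀ j → f j ≡ g j) → sumℤ n f ≡ sumℤ n g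
sum-cong zero    f≗g = refl
sum-cong (suc n) f≗g = cong₂ _+_ (sum-cong n f≗g) (f≗g n)

sum-+ : ∀ n (f g : ℕ → ℤ) → sumℤ n (λ j → f j + g j) ≡ sumℤ n f + sumℤ n g
sum-+ zero    f g = refl
sum-+ (suc n) f g = trans (cong (_+ (f n + g n)) (sum-+ n f g)) (interchange (sumℤ n f) (sumℤ n g) (f n) (g n))
  where
  interchange : ∀ a b c d → a + b + (c + d) ≡ a + c + (b + d)
  interchange = solve-∀

sum-*ˡ : ∀ n c (f : ℕ → ℤ) → sumℤ n (λ j → c * f j) ≡ c * sumℤ n f
sum-*ˡ zero    c f = sym (ℤₚ.*-zeroʳ c)
sum-*ˡ (suc n) c f = trans (cong (_+ c * f n) (sum-*ˡ n c f)) (sym (ℤₚ.*-distribˡ-+ c (sumℤ n f) (f n)))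

sum-telescope : ∀ n (h : ℕ → ℤ) → sumℤ n (λ j → h (suc j) - h j) ≡ h n - h 0
sum-telescope zero    h = sym (ℤₚ.+-inverseʳ (h 0))
sum-telescope (suc n) h = trans (cong (_+ (h (suc n) - h n)) (sum-telescope n h)) (cancel (h 0) (h n) (h (suc n)))
  where
  cancel : ∀ a b c → b - a + (c - b) ≡ c - a
  cancel = solve-∀

+sumℕ≡sumℤ : ∀ n (f : ℕ → ℕ) → + sumℕ n f ≡ sumℤ n (λ j → + f j)
+sumℕ≡sumℤ zero    f = refl
+sumℕ≡sumℤ (suc n) f = trans (ℤₚ.pos-+ (sumℕ n f) (f n)) (cong (_+ + f n) (+sumℕ≡sumℤ n f))

apéryTerm : ℕ → ℕ → ℤ
apéryTerm n j = binom n j * binom n j * binom (n ℕ.+ j) j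

β≡sum-apéryTerm : ∀ n → + β n ≡ sumℤ (suc n) (apéryTerm n)
β≡sum-apéryTerm n = trans (+sumℕ≡sumℤ (suc n) _) (sum-cong (suc n) λ j →
  trans (ℤₚ.pos-* ((n C j) ℕ.* (n C j)) ((n ℕ.+ j) C j)) (cong (_* binom (n ℕ.+ j) j) (ℤₚ.pos-* (n C j) (n C j))))

i∣j*[i*k] : ∀ i j k → i ∣ j * (i * k)
i∣j*[i*k] i j k = subst (ℕDiv._∣_ (ℤ.∣ i ∣)) (sym (trans (ℤₚ.abs-* j (i * k)) (cong (ℤ.∣ j ∣ ℕ.*_) (ℤₚ.abs-* i k))))
                        (ℕDiv.∣-trans (ℕDiv.m∣m*n ℤ.∣ k ∣) (ℕDiv.n∣m*n ℤ.∣ j ∣))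

*-chain : ∀ a k l m n {b c} → a * k ≡ m * b → b * l ≡ n * c → a * k * l ≡ m * n * c
*-chain a k l m n {b} {c} ak≡mb bl≡nc = begin
  a * k * l     ≡⟨ cong (_* l) ak≡mb ⟩
  m * b * l     ≡⟨ ℤₚ.*-assoc m b l ⟩
  m * (b * l)   ≡⟨ cong (m *_) bl≡nc ⟩
  m * (n * c)   ≡⟨ ℤₚ.*-assoc m n c ⟨
  m * n * c     ∎
  where open ≡-Reasoning

-- With x = C(n,i) and y = C(n+i+1,i+1), the hypotheses express every other binomial coefficient
-- of the recurrence at j = i + 1 as a rational multiple of x or y.
scaled-next-term : ∀ (N I x y cC cD P₁ : ℤ) →
  cC * (+ 2 + I) * (+ 1 + I) ≡ (+ 1 + N) * (N - I) * x →
  cD * (+ 1 + (N + (+ 1 + I)) - (+ 1 + I)) ≡ (+ 1 + (N + (+ 1 + I))) * y →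
  (+ 1 + I) * ((+ 1 + I) * ((+ 2 + I) * ((+ 2 + I) * ((+ 1 + N) * (cC * cC * cD * P₁)))))
    ≡ x * x * y * ((+ 1 + N) * (N - I) * ((+ 1 + N) * (N - I)) * (N + I + + 2) * P₁)
scaled-next-term N I x y cC cD P₁ hC hD = begin
  (+ 1 + I) * ((+ 1 + I) * ((+ 2 + I) * ((+ 2 + I) * ((+ 1 + N) * (cC * cC * cD * P₁)))))
    ≡⟨ solve (N ∷ I ∷ cC ∷ cD ∷ P₁ ∷ []) ⟩
  (cC * (+ 2 + I) * (+ 1 + I)) * (cC * (+ 2 + I) * (+ 1 + I)) * (cD * (+ 1 + (N + (+ 1 + I)) - (+ 1 + I))) * P₁
    ≡⟨ cong₂ (λ u v → u * u * v * P₁) hC hD ⟩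
  ((+ 1 + N) * (N - I) * x) * ((+ 1 + N) * (N - I) * x) * ((+ 1 + (N + (+ 1 + I))) * y) * P₁
    ≡⟨ solve (N ∷ I ∷ x ∷ y ∷ P₁ ∷ []) ⟩
  x * x * y * ((+ 1 + N) * (N - I) * ((+ 1 + N) * (N - I)) * (N + I + + 2) * P₁) ∎
  where open ≡-Reasoning

scaled-recurrence-rhs : ∀ (N I x y cA cB cE s Q P₀ R₁ R₂ : ℤ) →
  cA * (+ 1 + I) ≡ (N - I) * x →
  cB * (+ 2 + I) * (+ 1 + I) ≡ (N - (+ 1 + I)) * (N - I) * x →
  cE * (+ 2 + I) ≡ (+ 1 + (N + (+ 1 + I))) * y →
  (+ 1 + I) * ((+ 1 + I) * ((+ 2 + I) * ((+ 2 + I) * ((+ 1 + N) *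
      (s * (cB * cB * y * P₀) + Q * (cA * cA * y) + (cA * cB * cE * R₂ - x * cA * y * R₁))))))
    ≡ x * x * y * (s * ((N - (+ 1 + I)) * (N - I) * ((N - (+ 1 + I)) * (N - I)) * (+ 1 + N) * P₀)
      + Q * ((N - I) * (+ 2 + I) * ((N - I) * (+ 2 + I)) * (+ 1 + N))
      + ((N - I) * (N - I) * (N - (+ 1 + I)) * (N + I + + 2) * (+ 1 + N) * R₂
         - (N - I) * (+ 1 + I) * ((+ 2 + I) * (+ 2 + I)) * (+ 1 + N) * R₁))
scaled-recurrence-rhs N I x y cA cB cE s Q P₀ R₁ R₂ hA hB hE = begin
  (+ 1 + I) * ((+ 1 + I) * ((+ 2 + I) * ((+ 2 + I) * ((+ 1 + N) *
      (s * (cB * cB * y * P₀) + Q * (cA * cA * y) + (cA * cB * cE * R₂ - x * cA * y * R₁))))))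
    ≡⟨ solve (N ∷ I ∷ x ∷ y ∷ cA ∷ cB ∷ cE ∷ s ∷ Q ∷ P₀ ∷ R₁ ∷ R₂ ∷ []) ⟩
  s * ((cB * (+ 2 + I) * (+ 1 + I)) * (cB * (+ 2 + I) * (+ 1 + I)) * ((+ 1 + N) * y * P₀)) + Q * ((cA * (+ 1 + I)) * (cA * (+ 1 + I)) * ((+ 2 + I) * (+ 2 + I) * (+ 1 + N) * y))
      + ((cA * (+ 1 + I)) * (cB * (+ 2 + I) * (+ 1 + I)) * (cE * (+ 2 + I)) * ((+ 1 + N) * R₂) - x * (cA * (+ 1 + I)) * ((+ 1 + I) * (+ 2 + I) * (+ 2 + I) * (+ 1 + N) * y * R₁))
    ≡⟨ cong₂ (shape (cA * (+ 1 + I))) hB hE ⟩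
  shape (cA * (+ 1 + I)) ((N - (+ 1 + I)) * (N - I) * x) ((+ 1 + (N + (+ 1 + I))) * y)
    ≡⟨ cong (λ w → shape w ((N - (+ 1 + I)) * (N - I) * x) ((+ 1 + (N + (+ 1 + I))) * y)) hA ⟩
  s * (((N - (+ 1 + I)) * (N - I) * x) * ((N - (+ 1 + I)) * (N - I) * x) * ((+ 1 + N) * y * P₀)) + Q * (((N - I) * x) * ((N - I) * x) * ((+ 2 + I) * (+ 2 + I) * (+ 1 + N) * y))
      + (((N - I) * x) * ((N - (+ 1 + I)) * (N - I) * x) * ((+ 1 + (N + (+ 1 + I))) * y) * ((+ 1 + N) * R₂) - x * ((N - I) * x) * ((+ 1 + I) * (+ 2 + I) * (+ 2 + I) * (+ 1 + N) * y * R₁))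
    ≡⟨ solve (N ∷ I ∷ x ∷ y ∷ s ∷ Q ∷ P₀ ∷ R₁ ∷ R₂ ∷ []) ⟩
  x * x * y * (s * ((N - (+ 1 + I)) * (N - I) * ((N - (+ 1 + I)) * (N - I)) * (+ 1 + N) * P₀)
      + Q * ((N - I) * (+ 2 + I) * ((N - I) * (+ 2 + I)) * (+ 1 + N))
      + ((N - I) * (N - I) * (N - (+ 1 + I)) * (N + I + + 2) * (+ 1 + N) * R₂
         - (N - I) * (+ 1 + I) * ((+ 2 + I) * (+ 2 + I)) * (+ 1 + N) * R₁)) ∎
  where
  open ≡-Reasoning
  shape : ℤ → ℤ → ℤ → ℤ
  shape A B E = s * (B * B * ((+ 1 + N) * y * P₀)) + Q * (A * A * ((+ 2 + I) * (+ 2 + I) * (+ 1 + N) * y))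
      + (A * B * E * ((+ 1 + N) * R₂) - x * A * ((+ 1 + I) * (+ 2 + I) * (+ 2 + I) * (+ 1 + N) * y * R₁))

scaled-base-case : ∀ (N a b c s Q P₁ P₀ R : ℤ) → a ≡ + 1 + N → b ≡ N → c ≡ N + + 1 →
  (+ 1 + N) * (+ 1 + N) * P₁ ≡ s * (N * N * P₀) + Q + N * (N + + 1) * R →
  a * a * + 1 * P₁ ≡ s * (b * b * + 1 * P₀) + Q * (+ 1 * + 1 * + 1) + (+ 1 * b * c * R - + 0)
scaled-base-case N _ _ _ s Q P₁ P₀ R refl refl refl base = begin
  (+ 1 + N) * (+ 1 + N) * + 1 * P₁                                  ≡⟨ solve (N ∷ P₁ ∷ []) ⟩
  (+ 1 + N) * (+ 1 + N) * P₁                                        ≡⟨ base ⟩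
  s * (N * N * P₀) + Q + N * (N + + 1) * R                          ≡⟨ solve (N ∷ s ∷ Q ∷ P₀ ∷ R ∷ []) ⟩
  s * (N * N * + 1 * P₀) + Q * (+ 1 * + 1 * + 1) + (+ 1 * N * (N + + 1) * R - + 0) ∎
  where open ≡-Reasoning

-- The fields encode the recurrence for T and R below; base is its case j = 0, and shift its case
-- j = i + 1 multiplied by (i+1)² (i+2)² (n+1) / (C(n,i)² C(n+i+1,i+1)), which is a polynomial identity.
record Certificate : Set where
  field
    sign  : ℤ
    q     : ℤ → ℤ
    p r   : ℤ → ℤ → ℤ
    base  : ∀ N → (+ 1 + N) * (+ 1 + N) * p (+ 1 + N) (+ 0)
                    ≡ sign * (N * N * p N (+ 0)) + q N + N * (N + + 1) * r N (+ 1)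
    shift : ∀ N I →
      (+ 1 + N) * (N - I) * ((+ 1 + N) * (N - I)) * (N + I + + 2) * p (+ 1 + N) (+ 1 + I)
        ≡ sign * ((N - (+ 1 + I)) * (N - I) * ((N - (+ 1 + I)) * (N - I)) * (+ 1 + N) * p N (+ 1 + I))
            + q N * ((N - I) * (+ 2 + I) * ((N - I) * (+ 2 + I)) * (+ 1 + N))
            + ((N - I) * (N - I) * (N - (+ 1 + I)) * (N + I + + 2) * (+ 1 + N) * r N (+ 2 + I)
               - (N - I) * (+ 1 + I) * ((+ 2 + I) * (+ 2 + I)) * (+ 1 + N) * r N (+ 1 + I))

  T : ℕ → ℕ → ℤ
  T n j = binom n (suc j) * binom n (suc j) * binom (n ℕ.+ j) j * p (+ n) (+ j)

  R : ℕ → ℕ → ℤ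
  R n zero    = + 0
  R n (suc j) = binom n j * binom n (suc j) * binom (n ℕ.+ suc j) (suc j) * r (+ n) (+ suc j)

  T-step : ∀ n j → T (suc n) j ≡ sign * T n j + q (+ n) * apéryTerm n j + (R n (suc j) - R n j)
  T-step n zero = scaled-base-case (+ n) _ _ _ sign (q (+ n)) (p (+ suc n) (+ 0)) (p (+ n) (+ 0)) (r (+ n) (+ 1))
    (C[n,1]≡n (suc n)) (C[n,1]≡n n) (C[n,1]≡n (n ℕ.+ 1)) (base (+ n))
  T-step n (suc i) = cancel n (cancel (suc i) (cancel (suc i) (cancel i (cancel i (begin
      _ ≡⟨ scaled-next-term N I x y cC cD (p (+ 1 + N) (+ 1 + I)) hC hD ⟩
      _ ≡⟨ cong (x * x * y *_) (shift N I) ⟩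
      _ ≡⟨ scaled-recurrence-rhs N I x y cA cB cE sign (q N) (p N (+ 1 + I)) (r N (+ 1 + I)) (r N (+ 2 + I)) hA hB hE ⟨
      _ ∎)))))
    where
    open ≡-Reasoning
    N I x y cA cB cC cD cE : ℤ
    N  = + n
    I  = + i
    x  = binom n i
    y  = binom (n ℕ.+ suc i) (suc i)
    cA = binom n (suc i)
    cB = binom n (suc (suc i))
    cC = binom (suc n) (suc (suc i))
    cD = binom (suc n ℕ.+ suc i) (suc i)
    cE = binom (n ℕ.+ suc (suc i)) (suc (suc i))
    hA : cA * (+ 1 + I) ≡ (N - I) * x
    hA = C[n,1+k]*[1+k]≡[n-k]*C[n,k] n i
    hB : cB * (+ 2 + I) * (+ 1 + I) ≡ (N - (+ 1 + I)) * (N - I) * x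
    hB = *-chain cB (+ 2 + I) (+ 1 + I) (N - (+ 1 + I)) (N - I) (C[n,1+k]*[1+k]≡[n-k]*C[n,k] n (suc i)) hA
    hC : cC * (+ 2 + I) * (+ 1 + I) ≡ (+ 1 + N) * (N - I) * x
    hC = *-chain cC (+ 2 + I) (+ 1 + I) (+ 1 + N) (N - I) (C[1+n,1+k]*[1+k]≡[1+n]*C[n,k] n (suc i)) hA
    hD : cD * (+ 1 + (N + (+ 1 + I)) - (+ 1 + I)) ≡ (+ 1 + (N + (+ 1 + I))) * y
    hD = C[1+n,k]*[1+n-k]≡[1+n]*C[n,k] (n ℕ.+ suc i) (suc i)
    hE : cE * (+ 2 + I) ≡ (+ 1 + (N + (+ 1 + I))) * y
    hE = subst (λ m → binom m (suc (suc i)) * (+ 2 + I) ≡ (+ 1 + (N + (+ 1 + I))) * y) (sym (ℕₚ.+-suc n (suc i)))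
               (C[1+n,1+k]*[1+k]≡[1+n]*C[n,k] (n ℕ.+ suc i) (suc i))
    cancel : ∀ k {a b} → + suc k * a ≡ + suc k * b → a ≡ b
    cancel k = ℤₚ.*-cancelˡ-≡ (+ suc k) _ _

  T-diagonal : ∀ n → T n n ≡ + 0
  T-diagonal n = cong (λ c → c * c * binom (n ℕ.+ n) n * p (+ n) (+ n)) (C[n,1+n]≡0 n)

  R-beyond : ∀ n → R n (suc n) ≡ + 0
  R-beyond n = begin
    binom n n * binom n (suc n) * e * r′    ≡⟨ cong (λ c → binom n n * c * e * r′) (C[n,1+n]≡0 n) ⟩
    binom n n * + 0 * e * r′                ≡⟨ cong (λ c → c * e * r′) (ℤₚ.*-zeroʳ (binom n n)) ⟩
    + 0                                     ∎
    where
    open ≡-Reasoning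
    e  = binom (n ℕ.+ suc n) (suc n)
    r′ = r (+ n) (+ suc n)

  sum-T-step : ∀ n → sumℤ (suc n) (T (suc n)) ≡ sign * sumℤ n (T n) + q (+ n) * + β n
  sum-T-step n = begin
    sumℤ (suc n) (T (suc n))
      ≡⟨ sum-cong (suc n) (T-step n) ⟩
    sumℤ (suc n) (λ j → sign * T n j + q N * apéryTerm n j + (R n (suc j) - R n j))
      ≡⟨ sum-+ (suc n) _ _ ⟩
    sumℤ (suc n) (λ j → sign * T n j + q N * apéryTerm n j) + sumℤ (suc n) (λ j → R n (suc j) - R n j)
      ≡⟨ cong₂ _+_ (sum-+ (suc n) _ _) (sum-telescope (suc n) (R n)) ⟩
    sumℤ (suc n) (λ j → sign * T n j) + sumℤ (suc n) (λ j → q N * apéryTerm n j) + (R n (suc n) - + 0)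
      ≡⟨ cong₂ (λ a b → a + b + (R n (suc n) - + 0)) (sum-*ˡ (suc n) sign (T n)) (sum-*ˡ (suc n) (q N) (apéryTerm n)) ⟩
    sign * (sumℤ n (T n) + T n n) + q N * sumℤ (suc n) (apéryTerm n) + (R n (suc n) - + 0)
      ≡⟨ insert-zeros (T-diagonal n) (β≡sum-apéryTerm n) (R-beyond n) ⟩
    sign * (sumℤ n (T n) + + 0) + q N * + β n + (+ 0 - + 0)
      ≡⟨ drop-zeros sign (sumℤ n (T n)) (q N) (+ β n) ⟩
    sign * sumℤ n (T n) + q N * + β n ∎
    where
    open ≡-Reasoning
    N = + n
    insert-zeros : ∀ {t t′ b b′ e e′} → t ≡ t′ → b′ ≡ b → e ≡ e′ →
            sign * (sumℤ n (T n) + t) + q N * b + (e - + 0) ≡ sign * (sumℤ n (T n) + t′) + q N * b′ + (e′ - + 0)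
    insert-zeros refl refl refl = refl
    drop-zeros : ∀ s S c B → s * (S + + 0) + c * B + (+ 0 - + 0) ≡ s * S + c * B
    drop-zeros = solve-∀

  weighted-sum : (w : ℕ → ℤ) → (∀ k → w k ≡ sign * w (suc k)) →
                 ∀ n → sumℤ n (λ k → q (+ k) * w k * + β k) ≡ sign * w n * sumℤ n (T n)
  weighted-sum w w-step zero    = sym (ℤₚ.*-zeroʳ (sign * w 0))
  weighted-sum w w-step (suc n) = begin
    sumℤ n (λ k → q (+ k) * w k * + β k) + q (+ n) * w n * + β n
      ≡⟨ cong (_+ q (+ n) * w n * + β n) (weighted-sum w w-step n) ⟩
    sign * w n * sumℤ n (T n) + q (+ n) * w n * + β n
      ≡⟨ cong (λ v → sign * v * sumℤ n (T n) + q (+ n) * v * + β n) (w-step n) ⟩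
    sign * (sign * w (suc n)) * sumℤ n (T n) + q (+ n) * (sign * w (suc n)) * + β n
      ≡⟨ factor sign (w (suc n)) (sumℤ n (T n)) (q (+ n)) (+ β n) ⟩
    sign * w (suc n) * (sign * sumℤ n (T n) + q (+ n) * + β n)
      ≡⟨ cong (sign * w (suc n) *_) (sum-T-step n) ⟨
    sign * w (suc n) * sumℤ (suc n) (T (suc n)) ∎
    where
    open ≡-Reasoning
    factor : ∀ s v S c B → s * (s * v) * S + c * (s * v) * B ≡ s * v * (s * S + c * B)
    factor = solve-∀

  divides-weighted-sum : (w : ℕ → ℤ) → (∀ k → w k ≡ sign * w (suc k)) → ∀ n (d : ℤ) (X : ℕ → ℤ) →
                         (∀ j → T n j ≡ d * X j) → d ∣ sumℤ n (λ k → q (+ k) * w k * + β k)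
  divides-weighted-sum w w-step n d X T≡d*X =
    subst (d ∣_) (sym (trans (weighted-sum w w-step n) (cong (sign * w n *_) sum-T≡d*sum-X)))
          (i∣j*[i*k] d (sign * w n) (sumℤ n X))
    where
    sum-T≡d*sum-X : sumℤ n (T n) ≡ d * sumℤ n X
    sum-T≡d*sum-X = trans (sum-cong n T≡d*X) (sum-*ˡ n d X)

p₁ p₂ p₃ r₁ r₂ r₃ : ℤ → ℤ → ℤ
p₁ n j = n * (n + + 3 * j + + 3)
p₂ n j = n * (+ 3 * n - j - + 1)
p₃ n j = - (+ 3 * ((j + + 1) * (j + + 1))) + n * (j + + 1) * (+ 3 * j + + 2) + + 2 * (n * n) * j
r₁ n j = + 1 + + 2 * j - + 3 * (j * j) + n + + 3 * (n * j)
r₂ n j = + 3 - + 2 * j - j * j + + 9 * n - + 5 * (n * j) + + 6 * (n * n)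
r₃ n j = - + 2 - j * j + + 3 * (j * j * j) - + 6 * n + + 6 * (n * j) - + 7 * (n * (j * j)) - + 4 * (n * n) + + 4 * (n * n * j)

q₁ q₂ q₃ : ℤ → ℤ
q₁ n = + 11 * (n * n) + + 13 * n + + 4
q₂ n = + 11 * (n * n) + + 9 * n + + 2
q₃ n = + 11 * (n * n * n) + + 7 * (n * n) - + 1

-- In each certificate, base and shift restate the corresponding fields with p, q and r unfolded,
-- so that the ring solver can check them.
certificate₁ certificate₂ certificate₃ : Certificate
certificate₁ = record { sign = + 1 ; q = q₁ ; p = p₁ ; r = r₁ ; base = base ; shift = shift }
  where
  base : ∀ N →
    (+ 1 + N) * (+ 1 + N) * ((+ 1 + N) * ((+ 1 + N) + + 3 * + 0 + + 3))
      ≡ + 1 * (N * N * (N * (N + + 3 * + 0 + + 3)))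
        + (+ 11 * (N * N) + + 13 * N + + 4)
        + N * (N + + 1) * (+ 1 + + 2 * + 1 - + 3 * (+ 1 * + 1) + N + + 3 * (N * + 1))
  base = solve-∀
  shift : ∀ N I →
    (+ 1 + N) * (N - I) * ((+ 1 + N) * (N - I)) * (N + I + + 2)
      * ((+ 1 + N) * ((+ 1 + N) + + 3 * (+ 1 + I) + + 3))
      ≡ + 1 * ((N - (+ 1 + I)) * (N - I) * ((N - (+ 1 + I)) * (N - I)) * (+ 1 + N)
               * (N * (N + + 3 * (+ 1 + I) + + 3)))
        + (+ 11 * (N * N) + + 13 * N + + 4) * ((N - I) * (+ 2 + I) * ((N - I) * (+ 2 + I)) * (+ 1 + N))
        + ((N - I) * (N - I) * (N - (+ 1 + I)) * (N + I + + 2) * (+ 1 + N)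
             * (+ 1 + + 2 * (+ 2 + I) - + 3 * ((+ 2 + I) * (+ 2 + I)) + N + + 3 * (N * (+ 2 + I)))
           - (N - I) * (+ 1 + I) * ((+ 2 + I) * (+ 2 + I)) * (+ 1 + N)
             * (+ 1 + + 2 * (+ 1 + I) - + 3 * ((+ 1 + I) * (+ 1 + I)) + N + + 3 * (N * (+ 1 + I))))
  shift = solve-∀

certificate₂ = record { sign = - + 1 ; q = q₂ ; p = p₂ ; r = r₂ ; base = base ; shift = shift }
  where
  base : ∀ N →
    (+ 1 + N) * (+ 1 + N) * ((+ 1 + N) * (+ 3 * (+ 1 + N) - + 0 - + 1))
      ≡ (- + 1) * (N * N * (N * (+ 3 * N - + 0 - + 1)))
        + (+ 11 * (N * N) + + 9 * N + + 2)
        + N * (N + + 1) * (+ 3 - + 2 * + 1 - + 1 * + 1 + + 9 * N - + 5 * (N * + 1) + + 6 * (N * N))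
  base = solve-∀
  shift : ∀ N I →
    (+ 1 + N) * (N - I) * ((+ 1 + N) * (N - I)) * (N + I + + 2)
      * ((+ 1 + N) * (+ 3 * (+ 1 + N) - (+ 1 + I) - + 1))
      ≡ (- + 1) * ((N - (+ 1 + I)) * (N - I) * ((N - (+ 1 + I)) * (N - I)) * (+ 1 + N)
                   * (N * (+ 3 * N - (+ 1 + I) - + 1)))
        + (+ 11 * (N * N) + + 9 * N + + 2) * ((N - I) * (+ 2 + I) * ((N - I) * (+ 2 + I)) * (+ 1 + N))
        + ((N - I) * (N - I) * (N - (+ 1 + I)) * (N + I + + 2) * (+ 1 + N)
             * (+ 3 - + 2 * (+ 2 + I) - (+ 2 + I) * (+ 2 + I) + + 9 * N - + 5 * (N * (+ 2 + I)) + + 6 * (N * N))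
           - (N - I) * (+ 1 + I) * ((+ 2 + I) * (+ 2 + I)) * (+ 1 + N)
             * (+ 3 - + 2 * (+ 1 + I) - (+ 1 + I) * (+ 1 + I) + + 9 * N - + 5 * (N * (+ 1 + I)) + + 6 * (N * N)))
  shift = solve-∀

certificate₃ = record { sign = - + 1 ; q = q₃ ; p = p₃ ; r = r₃ ; base = base ; shift = shift }
  where
  base : ∀ N →
    (+ 1 + N) * (+ 1 + N) * ((- (+ 3 * ((+ 0 + + 1) * (+ 0 + + 1))) + (+ 1 + N) * (+ 0 + + 1) * (+ 3 * + 0 + + 2) + + 2 * ((+ 1 + N) * (+ 1 + N)) * + 0))
      ≡ (- + 1) * (N * N * ((- (+ 3 * ((+ 0 + + 1) * (+ 0 + + 1))) + N * (+ 0 + + 1) * (+ 3 * + 0 + + 2) + + 2 * (N * N) * + 0)))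
        + (+ 11 * (N * N * N) + + 7 * (N * N) - + 1)
        + N * (N + + 1) * (- + 2 - + 1 * + 1 + + 3 * (+ 1 * + 1 * + 1) - + 6 * N + + 6 * (N * + 1) - + 7 * (N * (+ 1 * + 1)) - + 4 * (N * N) + + 4 * (N * N * + 1))
  base = solve-∀
  shift : ∀ N I →
    (+ 1 + N) * (N - I) * ((+ 1 + N) * (N - I)) * (N + I + + 2)
      * ((- (+ 3 * (((+ 1 + I) + + 1) * ((+ 1 + I) + + 1))) + (+ 1 + N) * ((+ 1 + I) + + 1) * (+ 3 * (+ 1 + I) + + 2) + + 2 * ((+ 1 + N) * (+ 1 + N)) * (+ 1 + I)))
      ≡ (- + 1) * ((N - (+ 1 + I)) * (N - I) * ((N - (+ 1 + I)) * (N - I)) * (+ 1 + N)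
                   * ((- (+ 3 * (((+ 1 + I) + + 1) * ((+ 1 + I) + + 1))) + N * ((+ 1 + I) + + 1) * (+ 3 * (+ 1 + I) + + 2) + + 2 * (N * N) * (+ 1 + I))))
        + (+ 11 * (N * N * N) + + 7 * (N * N) - + 1) * ((N - I) * (+ 2 + I) * ((N - I) * (+ 2 + I)) * (+ 1 + N))
        + ((N - I) * (N - I) * (N - (+ 1 + I)) * (N + I + + 2) * (+ 1 + N)
             * (- + 2 - (+ 2 + I) * (+ 2 + I) + + 3 * ((+ 2 + I) * (+ 2 + I) * (+ 2 + I)) - + 6 * N + + 6 * (N * (+ 2 + I)) - + 7 * (N * ((+ 2 + I) * (+ 2 + I))) - + 4 * (N * N) + + 4 * (N * N * (+ 2 + I)))
           - (N - I) * (+ 1 + I) * ((+ 2 + I) * (+ 2 + I)) * (+ 1 + N)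
             * (- + 2 - (+ 1 + I) * (+ 1 + I) + + 3 * ((+ 1 + I) * (+ 1 + I) * (+ 1 + I)) - + 6 * N + + 6 * (N * (+ 1 + I)) - + 7 * (N * ((+ 1 + I) * (+ 1 + I))) - + 4 * (N * N) + + 4 * (N * N * (+ 1 + I))))
  shift = solve-∀

[1+m+j]Cj*[1+m]C[1+j]≡[1+m+j]C[2j+1]*[2j+1]Cj : ∀ m j →
  ((suc m ℕ.+ j) C j) ℕ.* (suc m C suc j) ≡ ((suc m ℕ.+ j) C (j ℕ.+ suc j)) ℕ.* ((j ℕ.+ suc j) C j)
[1+m+j]Cj*[1+m]C[1+j]≡[1+m+j]C[2j+1]*[2j+1]Cj m j with j ℕ.≤? m
... | yes j≤m = subst (λ m → ((suc m ℕ.+ j) C j) ℕ.* (suc m C suc j) ≡ ((suc m ℕ.+ j) C (j ℕ.+ suc j)) ℕ.* ((j ℕ.+ suc j) C j))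
                      (ℕₚ.m+[n∸m]≡n j≤m) ([b+c+a]Ca*[b+c]Cb≡[b+c+a]C[a+b]*[a+b]Ca j (suc j) (m ℕ.∸ j))
... | no j≰m = begin
  ((suc m ℕ.+ j) C j) ℕ.* (suc m C suc j)   ≡⟨ cong (((suc m ℕ.+ j) C j) ℕ.*_) (k>n⇒nCk≡0 (ℕ.s≤s m<j)) ⟩
  ((suc m ℕ.+ j) C j) ℕ.* 0                  ≡⟨ ℕₚ.*-zeroʳ ((suc m ℕ.+ j) C j) ⟩
  0                                          ≡⟨ cong (ℕ._* ((j ℕ.+ suc j) C j)) (k>n⇒nCk≡0 1+m+j<j+1+j) ⟨
  ((suc m ℕ.+ j) C (j ℕ.+ suc j)) ℕ.* ((j ℕ.+ suc j) C j) ∎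
  where
  open ≡-Reasoning
  m<j = ℕₚ.≰⇒> j≰m
  1+m+j<j+1+j : suc m ℕ.+ j ℕ.< j ℕ.+ suc j
  1+m+j<j+1+j = subst (suc m ℕ.+ j ℕ.<_) (sym (ℕₚ.+-suc j j)) (ℕ.s≤s (ℕₚ.+-monoˡ-< j m<j))

Y : ℕ → ℕ → ℤ
Y m j = binom m j * binom (suc m ℕ.+ j) (j ℕ.+ suc j) * binom (j ℕ.+ suc j) j

[1+j]*C[1+m,1+j]²C[1+m+j,j]≡[1+m]*Y : ∀ m j →
  (+ 1 + + j) * (binom (suc m) (suc j) * binom (suc m) (suc j) * binom (suc m ℕ.+ j) j) ≡ (+ 1 + + m) * Y m j
[1+j]*C[1+m,1+j]²C[1+m+j,j]≡[1+m]*Y m j = absorb (+ m) (+ j) c f e g h (C[1+n,1+k]*[1+k]≡[1+n]*C[n,k] m j) revision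
  where
  c f e g h : ℤ
  c = binom m j
  f = binom (suc m) (suc j)
  e = binom (suc m ℕ.+ j) j
  g = binom (suc m ℕ.+ j) (j ℕ.+ suc j)
  h = binom (j ℕ.+ suc j) j
  revision : e * f ≡ g * h
  revision = begin
    e * f                                                 ≡⟨ ℤₚ.pos-* ((suc m ℕ.+ j) C j) (suc m C suc j) ⟨
    + (((suc m ℕ.+ j) C j) ℕ.* (suc m C suc j))          ≡⟨ cong +_ ([1+m+j]Cj*[1+m]C[1+j]≡[1+m+j]C[2j+1]*[2j+1]Cj m j) ⟩
    + (((suc m ℕ.+ j) C (j ℕ.+ suc j)) ℕ.* ((j ℕ.+ suc j) C j)) ≡⟨ ℤₚ.pos-* ((suc m ℕ.+ j) C (j ℕ.+ suc j)) ((j ℕ.+ suc j) C j) ⟩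
    g * h                                                 ∎
    where open ≡-Reasoning
  absorb : ∀ M J c f e g h → f * (+ 1 + J) ≡ (+ 1 + M) * c → e * f ≡ g * h →
           (+ 1 + J) * (f * f * e) ≡ (+ 1 + M) * (c * g * h)
  absorb M J c f e g h hf hefgh = begin
    (+ 1 + J) * (f * f * e)      ≡⟨ solve (J ∷ f ∷ e ∷ []) ⟩
    (f * (+ 1 + J)) * (e * f)    ≡⟨ cong₂ _*_ hf hefgh ⟩
    ((+ 1 + M) * c) * (g * h)    ≡⟨ solve (M ∷ c ∷ g ∷ h ∷ []) ⟩
    (+ 1 + M) * (c * g * h)      ∎
    where open ≡-Reasoning

X₁ X₂ X₃ : ℕ → ℕ → ℤ
X₁ m j = binom m j * (binom (suc m ℕ.+ j) (suc (j ℕ.+ suc j)) * binom (j ℕ.+ suc j) j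
                    + binom (suc m ℕ.+ j) (j ℕ.+ suc j) * binom (suc (j ℕ.+ suc j)) (suc j))
X₂ m j = + 3 * X₁ m j - + 5 * Y m j
X₃ m j = - (+ 3 * (c * c * e)) + (+ 3 * + j + + 2) * (c * f * e) + + 2 * + j * (f * f * e)
  where
  c = binom m j
  f = binom (suc m) (suc j)
  e = binom (suc m ℕ.+ j) j

2[1+j]*X₁≡Y*[m+3j+4] : ∀ m j → + 2 * (+ 1 + + j) * X₁ m j ≡ Y m j * (+ m + + 3 * + j + + 4)
2[1+j]*X₁≡Y*[m+3j+4] m j = clear (+ m) (+ j) (binom m j) g h k₁ k₂
  (C[n,1+k]*[1+k]≡[n-k]*C[n,k] (suc m ℕ.+ j) (j ℕ.+ suc j))
  (C[1+n,1+k]*[1+k]≡[1+n]*C[n,k] (j ℕ.+ suc j) j)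
  where
  g h k₁ k₂ : ℤ
  g  = binom (suc m ℕ.+ j) (j ℕ.+ suc j)
  h  = binom (j ℕ.+ suc j) j
  k₁ = binom (suc m ℕ.+ j) (suc (j ℕ.+ suc j))
  k₂ = binom (suc (j ℕ.+ suc j)) (suc j)
  clear : ∀ M J c g h k₁ k₂ →
    k₁ * (+ 1 + (J + (+ 1 + J))) ≡ (+ 1 + M + J - (J + (+ 1 + J))) * g →
    k₂ * (+ 1 + J) ≡ (+ 1 + (J + (+ 1 + J))) * h →
    + 2 * (+ 1 + J) * (c * (k₁ * h + g * k₂)) ≡ c * g * h * (M + + 3 * J + + 4)
  clear M J c g h k₁ k₂ hk₁ hk₂ = begin
    + 2 * (+ 1 + J) * (c * (k₁ * h + g * k₂))
      ≡⟨ solve (J ∷ c ∷ g ∷ h ∷ k₁ ∷ k₂ ∷ []) ⟩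
    c * h * (k₁ * (+ 1 + (J + (+ 1 + J)))) + + 2 * c * g * (k₂ * (+ 1 + J))
      ≡⟨ cong₂ (λ u v → c * h * u + + 2 * c * g * v) hk₁ hk₂ ⟩
    c * h * ((+ 1 + M + J - (J + (+ 1 + J))) * g) + + 2 * c * g * ((+ 1 + (J + (+ 1 + J))) * h)
      ≡⟨ solve (M ∷ J ∷ c ∷ g ∷ h ∷ []) ⟩
    c * g * h * (M + + 3 * J + + 4) ∎
    where open ≡-Reasoning

2[1+j]*X₂≡Y*[3m-j+2] : ∀ m j → + 2 * (+ 1 + + j) * X₂ m j ≡ Y m j * (+ 3 * + m - + j + + 2)
2[1+j]*X₂≡Y*[3m-j+2] m j = clear (+ m) (+ j) (X₁ m j) (Y m j) (2[1+j]*X₁≡Y*[m+3j+4] m j)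
  where
  clear : ∀ M J X Y → + 2 * (+ 1 + J) * X ≡ Y * (M + + 3 * J + + 4) →
          + 2 * (+ 1 + J) * (+ 3 * X - + 5 * Y) ≡ Y * (+ 3 * M - J + + 2)
  clear M J X Y hX = begin
    + 2 * (+ 1 + J) * (+ 3 * X - + 5 * Y)        ≡⟨ solve (J ∷ X ∷ Y ∷ []) ⟩
    + 3 * (+ 2 * (+ 1 + J) * X) - + 10 * (+ 1 + J) * Y ≡⟨ cong (λ u → + 3 * u - + 10 * (+ 1 + J) * Y) hX ⟩
    + 3 * (Y * (M + + 3 * J + + 4)) - + 10 * (+ 1 + J) * Y ≡⟨ solve (M ∷ J ∷ Y ∷ []) ⟩
    Y * (+ 3 * M - J + + 2)                      ∎
    where open ≡-Reasoning

C[1+m,1+j]²C[1+m+j,j]*P≡2[1+m]²X : ∀ m j (P π X : ℤ) → P ≡ (+ 1 + + m) * π → + 2 * (+ 1 + + j) * X ≡ Y m j * π →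
  binom (suc m) (suc j) * binom (suc m) (suc j) * binom (suc m ℕ.+ j) j * P ≡ + 2 * (+ suc m * + suc m) * X
C[1+m,1+j]²C[1+m+j,j]*P≡2[1+m]²X m j P π X hP hX =
  ℤₚ.*-cancelˡ-≡ (+ suc j) _ _ (clear (+ m) (+ j) _ P (Y m j) π X ([1+j]*C[1+m,1+j]²C[1+m+j,j]≡[1+m]*Y m j) hP hX)
  where
  clear : ∀ M J Z P Y π X → (+ 1 + J) * Z ≡ (+ 1 + M) * Y → P ≡ (+ 1 + M) * π → + 2 * (+ 1 + J) * X ≡ Y * π →
          (+ 1 + J) * (Z * P) ≡ (+ 1 + J) * (+ 2 * ((+ 1 + M) * (+ 1 + M)) * X)
  clear M J Z P Y π X hZ hP hX = begin
    (+ 1 + J) * (Z * P)                              ≡⟨ ℤₚ.*-assoc (+ 1 + J) Z P ⟨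
    (+ 1 + J) * Z * P                                ≡⟨ cong₂ _*_ hZ hP ⟩
    (+ 1 + M) * Y * ((+ 1 + M) * π)                  ≡⟨ solve (M ∷ Y ∷ π ∷ []) ⟩
    (+ 1 + M) * (+ 1 + M) * (Y * π)                  ≡⟨ cong ((+ 1 + M) * (+ 1 + M) *_) hX ⟨
    (+ 1 + M) * (+ 1 + M) * (+ 2 * (+ 1 + J) * X)    ≡⟨ solve (M ∷ J ∷ X ∷ []) ⟩
    (+ 1 + J) * (+ 2 * ((+ 1 + M) * (+ 1 + M)) * X)  ∎
    where open ≡-Reasoning

T₁-factor : ∀ m j → Certificate.T certificate₁ (suc m) j ≡ + 2 * (+ suc m * + suc m) * X₁ m j
T₁-factor m j = C[1+m,1+j]²C[1+m+j,j]*P≡2[1+m]²X m j _ _ (X₁ m j) (p₁-factor (+ m) (+ j)) (2[1+j]*X₁≡Y*[m+3j+4] m j)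
  where
  p₁-factor : ∀ M J → (+ 1 + M) * ((+ 1 + M) + + 3 * J + + 3) ≡ (+ 1 + M) * (M + + 3 * J + + 4)
  p₁-factor = solve-∀

T₂-factor : ∀ m j → Certificate.T certificate₂ (suc m) j ≡ + 2 * (+ suc m * + suc m) * X₂ m j
T₂-factor m j = C[1+m,1+j]²C[1+m+j,j]*P≡2[1+m]²X m j _ _ (X₂ m j) (p₂-factor (+ m) (+ j)) (2[1+j]*X₂≡Y*[3m-j+2] m j)
  where
  p₂-factor : ∀ M J → (+ 1 + M) * (+ 3 * (+ 1 + M) - J - + 1) ≡ (+ 1 + M) * (+ 3 * M - J + + 2)
  p₂-factor = solve-∀

T₃-factor : ∀ m j → Certificate.T certificate₃ (suc m) j ≡ (+ suc m * + suc m) * X₃ m j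
T₃-factor m j = ℤₚ.*-cancelˡ-≡ (+ suc j) _ _ (ℤₚ.*-cancelˡ-≡ (+ suc j) _ _
  (clear (+ m) (+ j) (binom m j) (binom (suc m) (suc j)) (binom (suc m ℕ.+ j) j) (C[1+n,1+k]*[1+k]≡[1+n]*C[n,k] m j)))
  where
  clear : ∀ M J c f e → f * (+ 1 + J) ≡ (+ 1 + M) * c →
    (+ 1 + J) * ((+ 1 + J) * (f * f * e * p₃ (+ 1 + M) J))
      ≡ (+ 1 + J) * ((+ 1 + J) * ((+ 1 + M) * (+ 1 + M) * (- (+ 3 * (c * c * e)) + (+ 3 * J + + 2) * (c * f * e) + + 2 * J * (f * f * e))))
  clear M J c f e hf = begin
    (+ 1 + J) * ((+ 1 + J) * (f * f * e * (- (+ 3 * ((J + + 1) * (J + + 1))) + (+ 1 + M) * (J + + 1) * (+ 3 * J + + 2) + + 2 * ((+ 1 + M) * (+ 1 + M)) * J)))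
      ≡⟨ solve (M ∷ J ∷ f ∷ e ∷ []) ⟩
    (f * (+ 1 + J)) * (f * (+ 1 + J)) * e * (- (+ 3 * ((J + + 1) * (J + + 1))) + (+ 1 + M) * (J + + 1) * (+ 3 * J + + 2) + + 2 * ((+ 1 + M) * (+ 1 + M)) * J)
      ≡⟨ cong (λ u → u * u * e * (- (+ 3 * ((J + + 1) * (J + + 1))) + (+ 1 + M) * (J + + 1) * (+ 3 * J + + 2) + + 2 * ((+ 1 + M) * (+ 1 + M)) * J)) hf ⟩
    ((+ 1 + M) * c) * ((+ 1 + M) * c) * e * (- (+ 3 * ((J + + 1) * (J + + 1))) + (+ 1 + M) * (J + + 1) * (+ 3 * J + + 2) + + 2 * ((+ 1 + M) * (+ 1 + M)) * J)
      ≡⟨ solve (M ∷ J ∷ c ∷ e ∷ []) ⟩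
    - (+ 3 * ((+ 1 + J) * (+ 1 + J) * ((+ 1 + M) * c) * ((+ 1 + M) * c) * e))
      + (+ 3 * J + + 2) * (+ 1 + J) * (+ 1 + M) * ((+ 1 + M) * c) * ((+ 1 + M) * c) * e
      + + 2 * J * (+ 1 + M) * (+ 1 + M) * ((+ 1 + M) * c) * ((+ 1 + M) * c) * e
      ≡⟨ cong (λ u → - (+ 3 * ((+ 1 + J) * (+ 1 + J) * ((+ 1 + M) * c) * ((+ 1 + M) * c) * e))
                     + (+ 3 * J + + 2) * (+ 1 + J) * (+ 1 + M) * ((+ 1 + M) * c) * u * e
                     + + 2 * J * (+ 1 + M) * (+ 1 + M) * u * u * e) hf ⟨
    - (+ 3 * ((+ 1 + J) * (+ 1 + J) * ((+ 1 + M) * c) * ((+ 1 + M) * c) * e))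
      + (+ 3 * J + + 2) * (+ 1 + J) * (+ 1 + M) * ((+ 1 + M) * c) * (f * (+ 1 + J)) * e
      + + 2 * J * (+ 1 + M) * (+ 1 + M) * (f * (+ 1 + J)) * (f * (+ 1 + J)) * e
      ≡⟨ solve (M ∷ J ∷ c ∷ f ∷ e ∷ []) ⟩
    (+ 1 + J) * ((+ 1 + J) * ((+ 1 + M) * (+ 1 + M) * (- (+ 3 * (c * c * e)) + (+ 3 * J + + 2) * (c * f * e) + + 2 * J * (f * f * e)))) ∎
    where open ≡-Reasoning

sgn≡-1*sgn[1+k] : ∀ k → sgn k ≡ - + 1 * sgn (suc k)
sgn≡-1*sgn[1+k] k = sym (trans (ℤₚ.-1*i≡-i (- sgn k)) (ℤₚ.neg-involutive (sgn k)))

theorem1p1 : (n : ℕ) → .{{_ : NonZero n}} →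
    ((+ 2 * (+ n * + n)) ∣ sumℤ n (λ k → (+ 11 * (+ k * + k) + + 13 * + k + + 4) * + β k))
    × ((+ 2 * (+ n * + n)) ∣ sumℤ n (λ k → (+ 11 * (+ k * + k) + + 9 * + k + + 2) * sgn k * + β k))
    × ((+ n * + n) ∣ sumℤ n (λ k → (+ 11 * (+ k * + k * + k) + + 7 * (+ k * + k) - + 1) * sgn k * + β k))
-- There is no clause for n = 0: the instance NonZero 0 is empty.
theorem1p1 (suc m) =
    subst (2[1+m]² ∣_) (sum-cong (suc m) λ k → cong (_* + β k) (ℤₚ.*-identityʳ (q₁ (+ k))))
      (divides-weighted-sum certificate₁ (λ _ → + 1) (λ _ → refl) (suc m) 2[1+m]² (X₁ m) (T₁-factor m))
  , divides-weighted-sum certificate₂ sgn sgn≡-1*sgn[1+k] (suc m) 2[1+m]² (X₂ m) (T₂-factor m)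
  , divides-weighted-sum certificate₃ sgn sgn≡-1*sgn[1+k] (suc m) [1+m]² (X₃ m) (T₃-factor m)
  where
  open Certificate using (divides-weighted-sum)
  [1+m]² 2[1+m]² : ℤ
  [1+m]²  = + suc m * + suc m
  2[1+m]² = + 2 * [1+m]²
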